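{- Let $G$ be a finite simple graph on $n$ vertices and let $L$ be the Levi graph of the incidence structure $N(G)$. Then $L$ is connected if and only if $G$ is connected and non-bipartite.
   Context: For a vertex $v$ of $G$, $N(v)$ denotes the set of vertices adjacent to $v$. Let $S(G)=\{N(v)\mid v\in V(G)\}$ (a set, so equal neighbourhoods give a single element). The incidence structure $N(G)$ has the vertices of $G$ as points, the elements of $S(G)$ as blocks, and a point $u$ is incident with a block $B$ iff $u\in B$. The Levi graph of an incidence structure is the bipartite graph whose two vertex classes are the points and the blocks, a point being adjacent to a block iff they are incident. -}

module Defs where

open import Data.Nat using (ℕ)
open import Data.Bool using (Bool; true; false; _≟_)
open import Data.Fin using (Fin)
open import Data.Fin.Subset using (Subset; _∈_)
open import Data.Fin.Properties using (any?)
open import Data.Vec using (tabulate)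
open import Data.Vec.Properties using (≡-dec)
open import Data.Product using (Σ; ∃; _×_; _,_)
open import Data.Sum using (_⊎_; inj₁; inj₂)
open import Data.Empty using (⊥)
open import Relation.Nullary using (¬_)
open import Relation.Nullary.Decidable using (True)
open import Relation.Binary.PropositionalEquality using (_≡_)
open import Relation.Binary.Construct.Closure.ReflexiveTransitive using (Star)

record SimpleGraph (n : ℕ) : Set where
  field
    adj    : Fin n → Fin n → Bool
    sym    : ∀ u v → adj u v ≡ adj v u
    irrefl : ∀ v → adj v v ≡ false

open SimpleGraph public

Adj : ∀ {n} → SimpleGraph n → Fin n → Fin n → Set
Adj G u v = adj G u v ≡ true

Connected : (V : Set) → (V → V → Set) → Set
Connected V E = V × (∀ x y → Star E x y)

Bipartite : (V : Set) → (V → V → Set) → Set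
Bipartite V E = Σ (V → Bool) λ c → ∀ x y → E x y → ¬ (c x ≡ c y)

record IncidenceStructure : Set₁ where
  field
    Point : Set
    Block : Set
    I     : Point → Block → Set

open IncidenceStructure public

LeviVertex : IncidenceStructure → Set
LeviVertex S = Point S ⊎ Block S

LeviAdj : (S : IncidenceStructure) → LeviVertex S → LeviVertex S → Set
LeviAdj S (inj₁ p) (inj₂ B) = I S p B
LeviAdj S (inj₂ B) (inj₁ p) = I S p B
LeviAdj S (inj₁ _) (inj₁ _) = ⊥
LeviAdj S (inj₂ _) (inj₂ _) = ⊥

Nbhd : ∀ {n} → SimpleGraph n → Fin n → Subset n
Nbhd G v = tabulate (λ u → adj G v u)

-- The membership proof is the proof-irrelevant 'True' of a decision,
-- so each element of S(G) occurs exactly once (equal neighbourhoods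
-- give a single block).
NBlock : ∀ {n} → SimpleGraph n → Set
NBlock {n} G = Σ (Subset n) λ B → True (any? (λ v → ≡-dec _≟_ (Nbhd G v) B))

NStructure : ∀ {n} → SimpleGraph n → IncidenceStructure
NStructure {n} G = record
  { Point = Fin n
  ; Block = NBlock G
  ; I     = λ u B → u ∈ Σ.proj₁ B
  }
  where open import Data.Product using (Σ)

-- The Levi graph L of N(G) is a quotient of the bipartite double cover G × K₂: the point u
-- is the image of (u, 0) and the block N(v) that of (v, 1), since u ∈ N(v) iff v ~ u.  A walk
-- of G lifts to the cover sheet by sheet, and an odd closed walk joins the two sheets, so the
-- cover, and with it L, is connected when G is connected and non-bipartite.  Conversely L maps
-- onto G by sending a block to a vertex defining it, so G is connected; and a proper
-- 2-colouring c of G yields the colouring u ↦ c u, N(v) ↦ ¬ c v of L, constant along edges and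
-- hence constant, which is impossible since G has an edge (the point u and a block are joined).
module Submission where

open import Defs
open import Data.Nat using (ℕ)
open import Data.Fin using (Fin)
open import Data.Product using (_×_)
open import Function.Bundles using (_⇔_; mk⇔)
open import Relation.Nullary using (¬_)

open import Data.Bool using (Bool; true; false; not; _≟_)
open import Data.Bool.Properties using (not-involutive; ¬-not; T-irrelevant)
open import Data.Empty using (⊥-elim)
open import Data.Product using (∃; ∃₂; _,_; proj₁; proj₂)
open import Data.Product.Properties using (Σ-≡,≡→≡)
open import Data.Sum using (inj₁; inj₂)
open import Data.Fin.Properties using (any?)
open import Data.Fin.Subset using () renaming (_∈_ to _∈ₛ_)
open import Data.Vec.Properties using ([]=⇒lookup; lookup⇒[]=; lookup∘tabulate)
open import Relation.Nullary using (Dec; yes; no)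
open import Relation.Nullary.Decidable using (toWitness; fromWitness; _×-dec_)
open import Relation.Binary.PropositionalEquality
  using (_≡_; refl; trans; cong; subst) renaming (sym to ≡-sym)
open import Relation.Binary.Construct.Closure.ReflexiveTransitive
  using (Star; ε; _◅_; _◅◅_; gmap; reverse)

module _ {V : Set} {E : V → V → Set} where

  Star-invariant : {A : Set} (h : V → A) → (∀ {x y} → E x y → h x ≡ h y) →
                   ∀ {x y} → Star E x y → h x ≡ h y
  Star-invariant h h-E ε       = refl
  Star-invariant h h-E (e ◅ w) = trans (h-E e) (Star-invariant h h-E w)

  connected-image : {W : Set} {F : W → W → Set} → Connected V E →
                    (h : V → W) → (∀ {x y} → E x y → F (h x) (h y)) →
                    (∀ w → ∃ λ v → h v ≡ w) → Connected W F
  connected-image {F = F} (v , conn) h h-hom h-onto = h v , walk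
    where
    walk : ∀ w w′ → Star F w w′
    walk w w′ with h-onto w | h-onto w′
    ... | x , refl | y , refl = gmap h h-hom (conn x y)

module DoubleCover {V : Set} (E : V → V → Set) (E-sym : ∀ {x y} → E x y → E y x) where

  Cover : V × Bool → V × Bool → Set
  Cover (x , a) (y , b) = E x y × b ≡ not a

  Cover-sym : ∀ {s t} → Cover s t → Cover t s
  Cover-sym {x , a} {y , .(not a)} (e , refl) = E-sym e , ≡-sym (not-involutive a)

  lift : ∀ {x y} → Star E x y → ∀ a → ∃ λ b → Star Cover (x , a) (y , b)
  lift ε       a = a , ε
  lift (e ◅ w) a with lift w (not a)
  ... | b , w′ = b , (e , refl) ◅ w′

  Monochromatic : (V → Bool) → Set
  Monochromatic c = ∃₂ λ x y → E x y × c x ≡ c y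

  crossing : ∀ {z} b → Star Cover (z , b) (z , not b) → Star Cover (z , false) (z , true)
  crossing false w = w
  crossing true  w = reverse Cover-sym w

  module _ (monochromatic? : ∀ c → Dec (Monochromatic c))
           (connected : Connected V E) (non-bipartite : ¬ Bipartite V E) where

    private
      root = proj₁ connected
      conn = proj₂ connected

    parity : V → Bool
    parity x = proj₁ (lift (conn root x) false)

    parity-walk : ∀ x → Star Cover (root , false) (x , parity x)
    parity-walk x = proj₂ (lift (conn root x) false)

    parity-monochromatic : Monochromatic parity
    parity-monochromatic with monochromatic? parity
    ... | yes m = m
    ... | no ¬m = ⊥-elim (non-bipartite (parity , λ x y e same → ¬m (x , y , e , same)))

    -- A monochromatic edge of the parity colouring closes an odd walk through the root.
    sheets-joined : ∃ λ z → Star Cover (z , false) (z , true)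
    sheets-joined with parity-monochromatic
    ... | x , y , e , same = y , crossing (parity x) odd-walk
      where
      odd-walk : Star Cover (y , parity x) (y , not (parity x))
      odd-walk = subst (λ b → Star Cover (y , b) (root , false)) (≡-sym same)
                       (reverse Cover-sym (parity-walk y))
                 ◅◅ parity-walk x ◅◅ (e , refl) ◅ ε

    private
      z = proj₁ sheets-joined

    walk-to-hub : ∀ s → Star Cover s (z , false)
    walk-to-hub (x , a) with lift (conn x z) a
    ... | false , w = w
    ... | true  , w = w ◅◅ reverse Cover-sym (proj₂ sheets-joined)

    Cover-connected : Connected (V × Bool) Cover
    Cover-connected =
      (root , false) , λ s t → walk-to-hub s ◅◅ reverse Cover-sym (walk-to-hub t)

module _ {n : ℕ} (G : SimpleGraph n) where

  private
    L  = NStructure G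
    LV = LeviVertex L
    LA = LeviAdj L

  Adj-sym : ∀ {u v} → Adj G u v → Adj G v u
  Adj-sym {u} {v} e = trans (SimpleGraph.sym G v u) e

  ∈Nbhd⇒Adj : ∀ {v u} → u ∈ₛ Nbhd G v → Adj G v u
  ∈Nbhd⇒Adj {v} {u} p = trans (≡-sym (lookup∘tabulate (adj G v) u)) ([]=⇒lookup p)

  Adj⇒∈Nbhd : ∀ {v u} → Adj G v u → u ∈ₛ Nbhd G v
  Adj⇒∈Nbhd {v} {u} e = lookup⇒[]= u (Nbhd G v) (trans (lookup∘tabulate (adj G v) u) e)

  nbhdBlock : Fin n → NBlock G
  nbhdBlock v = Nbhd G v , fromWitness (v , refl)

  centre : NBlock G → Fin n
  centre B = proj₁ (toWitness (proj₂ B))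

  Nbhd-centre : ∀ B → Nbhd G (centre B) ≡ proj₁ B
  Nbhd-centre B = proj₂ (toWitness (proj₂ B))

  nbhdBlock-centre : ∀ B → nbhdBlock (centre B) ≡ B
  nbhdBlock-centre B = Σ-≡,≡→≡ (Nbhd-centre B , T-irrelevant _ _)

  incident⇒Adj : ∀ {u B} → I L u B → Adj G (centre B) u
  incident⇒Adj {u} {B} p = ∈Nbhd⇒Adj (subst (u ∈ₛ_) (≡-sym (Nbhd-centre B)) p)

  open DoubleCover (Adj G) Adj-sym using (Cover; Monochromatic; Cover-connected)

  monochromatic? : ∀ c → Dec (Monochromatic c)
  monochromatic? c = any? λ x → any? λ y → (adj G x y ≟ true) ×-dec (c x ≟ c y)

  levi-connected⇒connected : Connected LV LA → Connected (Fin n) (Adj G)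
  levi-connected⇒connected conn =
    connected-image conn vertex (λ {a} {b} → vertex-hom {a} {b}) (λ v → inj₁ v , refl)
    where
    vertex : LV → Fin n
    vertex (inj₁ u) = u
    vertex (inj₂ B) = centre B

    vertex-hom : ∀ {a b} → LA a b → Adj G (vertex a) (vertex b)
    vertex-hom {inj₁ u} {inj₂ B} p = Adj-sym (incident⇒Adj p)
    vertex-hom {inj₂ B} {inj₁ u} p = incident⇒Adj p

  -- The walk from a point to a block is non-empty, and its first step is an edge of G.
  levi-connected⇒edge : Connected LV LA → ∃₂ (Adj G)
  levi-connected⇒edge conn = first-step (proj₂ conn (inj₁ u) (inj₂ (nbhdBlock u)))
    where
    u = proj₁ (levi-connected⇒connected conn)

    first-step : ∀ {B} → Star LA (inj₁ u) (inj₂ B) → ∃₂ (Adj G)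
    first-step (_◅_ {j = inj₂ B} p _) = centre B , u , incident⇒Adj p

  levi-connected⇒¬bipartite : Connected LV LA → ¬ Bipartite (Fin n) (Adj G)
  levi-connected⇒¬bipartite conn (c , proper) with levi-connected⇒edge conn
  ... | x , y , e = proper x y e
    (Star-invariant colour (λ {a} {b} → colour-constant {a} {b}) (proj₂ conn (inj₁ x) (inj₁ y)))
    where
    colour : LV → Bool
    colour (inj₁ u) = c u
    colour (inj₂ B) = not (c (centre B))

    colour-constant : ∀ {a b} → LA a b → colour a ≡ colour b
    colour-constant {inj₁ u} {inj₂ B} p = ¬-not λ same → proper _ _ (incident⇒Adj p) (≡-sym same)
    colour-constant {inj₂ B} {inj₁ u} p = ≡-sym (colour-constant {inj₁ u} {inj₂ B} p)

  cover-to-levi : Fin n × Bool → LV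
  cover-to-levi (v , false) = inj₁ v
  cover-to-levi (v , true)  = inj₂ (nbhdBlock v)

  cover-to-levi-hom : ∀ {s t} → Cover s t → LA (cover-to-levi s) (cover-to-levi t)
  cover-to-levi-hom {u , false} {v , .true}  (e , refl) = Adj⇒∈Nbhd (Adj-sym e)
  cover-to-levi-hom {u , true}  {v , .false} (e , refl) = Adj⇒∈Nbhd e

  cover-to-levi-onto : ∀ a → ∃ λ s → cover-to-levi s ≡ a
  cover-to-levi-onto (inj₁ u) = (u , false) , refl
  cover-to-levi-onto (inj₂ B) = (centre B , true) , cong inj₂ (nbhdBlock-centre B)

  connected-non-bipartite⇒levi-connected :
    Connected (Fin n) (Adj G) → ¬ Bipartite (Fin n) (Adj G) → Connected LV LA
  connected-non-bipartite⇒levi-connected conn non-bipartite =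
    connected-image (Cover-connected monochromatic? conn non-bipartite)
                    cover-to-levi (λ {s} {t} → cover-to-levi-hom {s} {t}) cover-to-levi-onto

proposition2p2 : (n : ℕ) (G : SimpleGraph n) →
    Connected (LeviVertex (NStructure G)) (LeviAdj (NStructure G))
      ⇔ (Connected (Fin n) (Adj G) × ¬ Bipartite (Fin n) (Adj G))
proposition2p2 n G = mk⇔
  (λ conn → levi-connected⇒connected G conn , levi-connected⇒¬bipartite G conn)
  (λ (conn , non-bipartite) → connected-non-bipartite⇒levi-connected G conn non-bipartite)
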